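{- Let $\mathbb{F}$ be a field of positive characteristic $p$ and $S$ an association scheme on a finite set $X$ with $O^\vartheta(S)\subseteq O_\vartheta(S)$. If $S$ is $p$-transitive, then $S$ is the unique closed subset of $S$ containing $S_{p'}$.
   Context: $S=\{R_0,\dots,R_d\}$ is an association scheme on $X$ with diagonal $R_0$, transposes $R_{i^*}$, intersection numbers $p_{ij}^k$, valencies $k_i=p_{ii^*}^0$. $S_{p'}=\{R_i\in S:p\nmid k_i\}$. For nonempty $U,V\subseteq S$, $UV=\{R_k:\exists R_u\in U,R_v\in V,\ p_{uv}^k>0\}$. A nonempty $T\subseteq S$ is closed if $T^*T\subseteq T$ ($T^*=\{R_{i^*}:R_i\in T\}$), strongly normal if also $R_{i^*}TR_i\subseteq T$ for all $i$. $O_\vartheta(S)=\{R_i:k_i=1\}$; $O^\vartheta(S)$ is the intersection of all strongly normal closed subsets. $\overline{A_i}$ is the image in $M_X(\mathbb{F})$ of the adjacency matrix of $R_i$, $\mathbb{F}S=\mathrm{span}_{\mathbb{F}}\{\overline{A_i}\}$, $\overline{k_i}$ the image of $k_i$ in $\mathbb{F}$. A trivial submodule of the regular $\mathbb{F}S$-module is $\langle v\rangle_{\mathbb{F}}$ with $0\ne v\in\mathbb{F}S$ and $\overline{A_i}v=\overline{k_i}v$ for all $i$; $S$ is $p$-transitive if there is exactly one such submodule. -}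

module Defs where

open import Level using (Level; _⊔_) renaming (suc to lsuc; zero to lzero)
open import Data.Nat using (ℕ; zero; suc; _<_; _≤_)
open import Data.Nat.Divisibility using (_∣_)
open import Data.Nat.Primality using (Prime)
open import Data.Fin using (Fin) renaming (zero to fzero)
open import Data.Fin.Properties using (_≟_)
open import Data.List using (List; length; filter)
open import Data.List.Base using () 
open import Data.Fin.Base using ()
open import Data.Product using (Σ; ∃; ∃₂; _×_; _,_)
open import Data.Product.Nary.NonDependent using ()
open import Data.Bool using (if_then_else_)
open import Relation.Nullary using (¬_; Dec; ⌊_⌋)
open import Relation.Nullary.Decidable using (_×-dec_)
open import Relation.Binary.PropositionalEquality using (_≡_)
open import Algebra.Bundles using (CommutativeRing)
import Algebra.Definitions.RawMonoid as RawMonoidDefs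
import Data.List as L

record Field (c ℓ : Level) : Set (lsuc (c ⊔ ℓ)) where
  field
    commutativeRing : CommutativeRing c ℓ
  open CommutativeRing commutativeRing public
  field
    1≉0     : ¬ (1# ≈ 0#)
    inverse : ∀ x → ¬ (x ≈ 0#) → ∃ λ y → (x * y) ≈ 1#

module FieldOps {c ℓ} (F : Field c ℓ) where
  open Field F
  open RawMonoidDefs +-rawMonoid public using (sum) renaming (_×_ to _·1×_)

  ι : ℕ → Carrier
  ι m = m ·1× 1#

HasCharacteristic : ∀ {c ℓ} → Field c ℓ → ℕ → Set ℓ
HasCharacteristic F p =
  (0 < p) × (ι p ≈ 0#) × (∀ m → 0 < m → ι m ≈ 0# → p ≤ m)
  where open Field F
        open FieldOps F

count : ∀ {n} {P : Fin n → Set} → (∀ z → Dec (P z)) → ℕ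
count {n} P? = length (filter P? (L.allFin n))

-- Association schemes on X = Fin n with relations R_0,…,R_d, given by
-- the map rel : X × X → {0,…,d}, (x,y) ↦ the i with (x,y) ∈ R_i.

record Scheme (n d : ℕ) : Set where
  field
    rel       : Fin n → Fin n → Fin (suc d)
    nonempty  : ∀ i → ∃₂ λ x y → rel x y ≡ i
    diag₁     : ∀ x → rel x x ≡ fzero
    diag₂     : ∀ x y → rel x y ≡ fzero → x ≡ y
    tr        : Fin (suc d) → Fin (suc d)
    tr-spec   : ∀ x y → rel y x ≡ tr (rel x y)
    p         : Fin (suc d) → Fin (suc d) → Fin (suc d) → ℕ
    p-spec    : ∀ i j k x y → rel x y ≡ k →
                count (λ z → (rel x z ≟ i) ×-dec (rel z y ≟ j)) ≡ p i j k

  Idx : Set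
  Idx = Fin (suc d)

  val : Idx → ℕ
  val i = p i (tr i) fzero

  SubsetS : Set₁
  SubsetS = Idx → Set

  _⊆_ : SubsetS → SubsetS → Set
  U ⊆ V = ∀ i → U i → V i

  _⋆_ : SubsetS → SubsetS → SubsetS
  (U ⋆ V) k = ∃₂ λ u v → U u × V v × 0 < p u v k

  _ᵀ : SubsetS → SubsetS
  (U ᵀ) k = ∃ λ i → U i × tr i ≡ k

  ⟨_⟩ : Idx → SubsetS
  ⟨ i ⟩ j = j ≡ i

  Closed : SubsetS → Set
  Closed T = (∃ λ i → T i) × (((T ᵀ) ⋆ T) ⊆ T)

  StronglyNormalClosed : SubsetS → Set
  StronglyNormalClosed T = Closed T × (∀ i → ((⟨ tr i ⟩ ⋆ T) ⋆ ⟨ i ⟩) ⊆ T)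

  Oθ-lower : SubsetS
  Oθ-lower i = val i ≡ 1

  Oθ-upper : Idx → Set₁
  Oθ-upper i = ∀ (T : SubsetS) → StronglyNormalClosed T → T i

  Sp′ : ℕ → SubsetS
  Sp′ q i = ¬ (q ∣ val i)

  module OverField {c ℓ} (F : Field c ℓ) where
    open Field F
    open FieldOps F

    Mat : Set c
    Mat = Fin n → Fin n → Carrier

    A : Idx → Mat
    A i x y = if ⌊ rel x y ≟ i ⌋ then 1# else 0#

    _·M_ : Mat → Mat → Mat
    (M ·M N) x y = sum (λ z → M x z * N z y)

    InFS : Mat → Set (c ⊔ ℓ)
    InFS v = ∃ λ (a : Idx → Carrier) →
               ∀ x y → v x y ≈ sum (λ i → a i * A i x y)

    NonZeroM : Mat → Set ℓ
    NonZeroM v = ∃₂ λ x y → ¬ (v x y ≈ 0#)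

    -- v spans a trivial submodule of the regular F S-module
    TrivialVec : Mat → Set (c ⊔ ℓ)
    TrivialVec v = InFS v × NonZeroM v ×
                   (∀ i x y → (A i ·M v) x y ≈ ι (val i) * v x y)

    SameSpan : Mat → Mat → Set (c ⊔ ℓ)
    SameSpan v w = (∃ λ a → ∀ x y → w x y ≈ a * v x y)
                 × (∃ λ a → ∀ x y → v x y ≈ a * w x y)

    PTransitive : Set (c ⊔ ℓ)
    PTransitive = (∃ λ v → TrivialVec v)
                × (∀ v w → TrivialVec v → TrivialVec w → SameSpan v w)

module Submission where

-- For a closed subset C, x ∼ y :⇔ rel x y ∈ C is an equivalence relation on X.
-- If C contains S_{p'} and every product R_{j*}R_j, then row x of A_j meets the
-- ∼-class of y in either none or all k_j of its points: for j ∈ C in all of them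
-- exactly when rel x y ∈ C, while for j ∉ C we have k_j ≡ 0 (mod p) anyway.
-- Hence A⁺ = Σ_{i ∈ C} A_i spans a trivial submodule, as does the all-ones matrix,
-- and p-transitivity makes them proportional, forcing C = S. The products R_{j*}R_j
-- lie in O^θ ⊆ O_θ, so they have valency 1 and belong to S_{p'}. A closed T ⊇ S_{p'}
-- need not be decidable, so C is taken to be a decidable closed subset between
-- S_{p'} and T, obtained by iterating the closure step up to a fixpoint.

open import Defs
open import Level using (Level; 0ℓ)
open import Data.Nat using (ℕ; zero; suc; _<_; _<?_)
import Data.Nat as ℕ
open import Data.Nat.Divisibility using (_∣_; _∣?_; divides)
open import Data.Fin using (Fin; punchIn) renaming (zero to fzero; suc to fsuc)
open import Data.Fin.Properties using (_≟_; any?; punchInᵢ≢i)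
open import Data.Bool using (if_then_else_)
open import Data.Product using (_×_; ∃; _,_; proj₁; proj₂)
open import Data.Sum using (_⊎_; inj₁; inj₂)
open import Data.Unit using (⊤; tt)
open import Data.List using (length; filter; tabulate; allFin)
import Data.List.Relation.Unary.Any.Properties as Any
open import Data.List.Properties using (filter-some; filter-≐)
open import Data.Vec.Functional using (replicate)
open import Function using (_∘_)
open import Relation.Nullary using (¬_; Dec; yes; no; does; ⌊_⌋; ¬?; contradiction)
open import Relation.Nullary.Decidable using (_×-dec_; _⊎-dec_; dec-true; decidable-stable)
open import Relation.Unary using (Pred; Decidable)
open import Relation.Binary.Structures using (IsEquivalence)
open import Relation.Binary.PropositionalEquality as ≡ using (_≡_)

module SubsetClosure {m : ℕ} where
  open import Data.Fin.Subset using (Subset; _∈_; _⊆_; _⊃_)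
  open import Data.Fin.Subset.Properties using (_∈?_; ⊆-refl; ⊆-trans)
  open import Data.Fin.Subset.Induction using (⊃-wellFounded; Acc; acc)
  open import Data.Vec using (lookup) renaming (tabulate to tabulateᵛ)
  open import Data.Vec.Properties using (lookup∘tabulate; []=⇒lookup; lookup⇒[]=)

  toSubset : {P : Pred (Fin m) 0ℓ} → Decidable P → Subset m
  toSubset P? = tabulateᵛ (does ∘ P?)

  ∈-toSubset⁺ : {P : Pred (Fin m) 0ℓ} (P? : Decidable P) {x : Fin m} → P x → x ∈ toSubset P?
  ∈-toSubset⁺ P? {x} px = lookup⇒[]= x _ (≡.trans (lookup∘tabulate _ x) (dec-true (P? x) px))

  ∈-toSubset⁻ : {P : Pred (Fin m) 0ℓ} (P? : Decidable P) {x : Fin m} → x ∈ toSubset P? → P x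
  ∈-toSubset⁻ P? {x} x∈ with P? x | ≡.trans (≡.sym (lookup∘tabulate (does ∘ P?) x)) ([]=⇒lookup x∈)
  ... | yes px | _ = px
  ... | no _   | ()

  postfixedPoint-above : (step : Subset m → Subset m) → (∀ p → p ⊆ step p) →
                         (Inv : Subset m → Set) → (∀ p → Inv p → Inv (step p)) →
                         ∀ p → Inv p → ∃ λ q → p ⊆ q × step q ⊆ q × Inv q
  postfixedPoint-above step inflationary Inv preserves p = go p (⊃-wellFounded p)
    where
    go : ∀ p → Acc _⊃_ p → Inv p → ∃ λ q → p ⊆ q × step q ⊆ q × Inv q
    go p (acc rec) inv with any? (λ x → (x ∈? step p) ×-dec ¬? (x ∈? p))
    ... | no noNew =
      p , ⊆-refl , (λ {x} x∈ → decidable-stable (x ∈? p) (λ x∉ → noNew (x , x∈ , x∉))) , inv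
    ... | yes (x , x∈ , x∉) with go (step p) (rec (inflationary p , x , x∈ , x∉)) (preserves p inv)
    ...   | q , step-p⊆q , fixed , invq = q , ⊆-trans (inflationary p) step-p⊆q , fixed , invq

module FieldSums {c ℓ : Level} (F : Field c ℓ) where
  open Field F
  open FieldOps F using (sum; ι; _·1×_)
  open import Algebra.Properties.Monoid.Mult +-monoid using (×-assocˡ; ×-congʳ)
  open import Algebra.Properties.Semiring.Sum semiring using (sum-replicate; sum-replicate-zero)
  open import Relation.Binary.Reasoning.Setoid setoid

  indicator : {P : Set} → Dec P → Carrier
  indicator P? = if ⌊ P? ⌋ then 1# else 0#

  indicator-yes : {P : Set} (P? : Dec P) → P → indicator P? ≈ 1#
  indicator-yes (yes _) _  = refl
  indicator-yes (no ¬p) p = contradiction p ¬p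

  indicator-no : {P : Set} (P? : Dec P) → ¬ P → indicator P? ≈ 0#
  indicator-no (yes p) ¬p = contradiction p ¬p
  indicator-no (no _)  _  = refl

  sum-indicator≈ι-length : ∀ {m k} {P : Pred (Fin k) 0ℓ} (P? : Decidable P) (f : Fin m → Fin k) →
                           sum (λ i → indicator (P? (f i))) ≈ ι (length (filter P? (tabulate f)))
  sum-indicator≈ι-length {zero}  P? f = refl
  sum-indicator≈ι-length {suc m} P? f with P? (f fzero)
  ... | yes _ = +-congˡ (sum-indicator≈ι-length P? (f ∘ fsuc))
  ... | no _  = trans (+-identityˡ _) (sum-indicator≈ι-length P? (f ∘ fsuc))

  sum-indicator≈ι-count : ∀ {m} {P : Pred (Fin m) 0ℓ} (P? : Decidable P) →
                          sum (indicator ∘ P?) ≈ ι (count P?)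
  sum-indicator≈ι-count P? = sum-indicator≈ι-length P? (λ i → i)

  module Characteristic {q : ℕ} (char : HasCharacteristic F q) where

    ι-divisible≈0 : ∀ {m} → q ∣ m → ι m ≈ 0#
    ι-divisible≈0 (divides k ≡.refl) = begin
      ι (k ℕ.* q)          ≈⟨ ×-assocˡ 1# k q ⟨
      k ·1× ι q            ≈⟨ ×-congʳ k (proj₁ (proj₂ char)) ⟩
      k ·1× 0#             ≈⟨ sum-replicate k ⟨
      sum (replicate k 0#) ≈⟨ sum-replicate-zero k ⟩
      0#                   ∎

    char∤1 : ¬ q ∣ 1
    char∤1 q∣1 = 1≉0 (trans (sym (+-identityʳ 1#)) (ι-divisible≈0 q∣1))

module SchemeProperties {n d : ℕ} (S : Scheme n d) where
  open Scheme S
  open import Data.Fin.Subset using (Subset; _∈_)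
  open import Data.Fin.Subset.Properties using (_∈?_)
  open SubsetClosure

  p-positive : ∀ x y z → 0 < p (rel x y) (rel y z) (rel x z)
  p-positive x y z = ≡.subst (0 <_) (p-spec (rel x y) (rel y z) (rel x z) x z ≡.refl)
    (filter-some (λ w → (rel x w ≟ rel x y) ×-dec (rel w z ≟ rel y z))
                 (Any.tabulate⁺ y (≡.refl , ≡.refl)))

  p-i0i-positive : ∀ i → 0 < p i fzero i
  p-i0i-positive i with nonempty i
  ... | x , y , ≡.refl = ≡.subst (λ o → 0 < p (rel x y) o (rel x y)) (diag₁ y) (p-positive x y y)

  j*j-positive : ∀ {x z₀ z} → rel x z₀ ≡ rel x z → 0 < p (tr (rel x z)) (rel x z) (rel z₀ z)
  j*j-positive {x} {z₀} {z} e =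
    ≡.subst (λ i → 0 < p i (rel x z) (rel z₀ z)) (≡.trans (tr-spec x z₀) (≡.cong tr e)) (p-positive z₀ x z)

  val≡rowCount : ∀ x j → val j ≡ count (λ z → rel x z ≟ j)
  val≡rowCount x j = ≡.trans (≡.sym (p-spec j (tr j) fzero x x (diag₁ x)))
    (≡.cong length (filter-≐ (λ z → (rel x z ≟ j) ×-dec (rel z x ≟ tr j)) (λ z → rel x z ≟ j)
                             (proj₁ , λ {z} e → e , ≡.trans (tr-spec x z) (≡.cong tr e)) (allFin n)))

  ProductClosed : SubsetS → Set
  ProductClosed U = ((U ᵀ) ⋆ U) ⊆ U

  ᵀ-dec : {U : SubsetS} → Decidable U → Decidable (U ᵀ)
  ᵀ-dec U? k = any? (λ i → U? i ×-dec (tr i ≟ k))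

  ⋆-dec : {U V : SubsetS} → Decidable U → Decidable V → Decidable (U ⋆ V)
  ⋆-dec U? V? k = any? (λ u → any? (λ v → U? u ×-dec V? v ×-dec (0 <? p u v k)))

  ᵀ⋆-mono : {U V : SubsetS} → U ⊆ V → ((U ᵀ) ⋆ U) ⊆ ((V ᵀ) ⋆ V)
  ᵀ⋆-mono U⊆V k (u , v , (i , Ui , tri≡u) , Uv , pos) = u , v , (i , U⊆V i Ui , tri≡u) , U⊆V v Uv , pos

  productClosed⇒euclidean : {U : SubsetS} → ProductClosed U →
                            ∀ {x y z} → U (rel y x) → U (rel y z) → U (rel x z)
  productClosed⇒euclidean closed {x} {y} {z} Uyx Uyz =
    closed (rel x z) (rel x y , rel y z , (rel y x , Uyx , ≡.sym (tr-spec y x)) , Uyz , p-positive x y z)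

  closed⇒0∈ : {U : SubsetS} → Closed U → U fzero
  closed⇒0∈ {U} ((i , Ui) , closed) with nonempty i
  ... | x , y , ≡.refl = ≡.subst U (diag₁ y) (productClosed⇒euclidean closed Ui Ui)

  closed⇒isEquivalence : {U : SubsetS} → Closed U → IsEquivalence (λ x y → U (rel x y))
  closed⇒isEquivalence {U} U-closed@(_ , closed) = record
    { refl  = ∼-refl
    ; sym   = ∼-sym
    ; trans = λ Uxy Uyz → productClosed⇒euclidean closed (∼-sym Uxy) Uyz
    }
    where
    ∼-refl : ∀ {x} → U (rel x x)
    ∼-refl {x} = ≡.subst U (≡.sym (diag₁ x)) (closed⇒0∈ U-closed)
    ∼-sym : ∀ {x y} → U (rel x y) → U (rel y x)
    ∼-sym Uxy = productClosed⇒euclidean closed Uxy ∼-refl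

  j*j⊆Oθ-upper : ∀ j {k} → 0 < p (tr j) j k → Oθ-upper k
  j*j⊆Oθ-upper j pos T ((T-nonempty , closed) , normal) =
    normal j _ (tr j , j , (tr j , fzero , ≡.refl , closed⇒0∈ (T-nonempty , closed) , p-i0i-positive (tr j))
               , ≡.refl , pos)

  grow? : (B : Subset (suc d)) → Decidable (λ k → k ∈ B ⊎ (((_∈ B) ᵀ) ⋆ (_∈ B)) k)
  grow? B k = (k ∈? B) ⊎-dec ⋆-dec (ᵀ-dec (_∈? B)) (_∈? B) k

  closureStep : Subset (suc d) → Subset (suc d)
  closureStep B = toSubset (grow? B)

  decidableClosed-between : {U T : SubsetS} → Decidable U → Closed T → U ⊆ T →
    ∃ λ (C : Subset (suc d)) → U ⊆ (_∈ C) × ProductClosed (_∈ C) × (_∈ C) ⊆ T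
  decidableClosed-between {U} {T} U? (_ , T-closed) U⊆T
    with postfixedPoint-above closureStep (λ B x∈ → ∈-toSubset⁺ (grow? B) (inj₁ x∈))
           (λ B → (_∈ B) ⊆ T) step-within-T (toSubset U?) (λ i → U⊆T i ∘ ∈-toSubset⁻ U?)
    where
    step-within-T : ∀ B → (_∈ B) ⊆ T → (_∈ closureStep B) ⊆ T
    step-within-T B B⊆T k k∈ with ∈-toSubset⁻ (grow? B) k∈
    ... | inj₁ k∈B = B⊆T k k∈B
    ... | inj₂ prod = T-closed k (ᵀ⋆-mono B⊆T k prod)
  ... | C , U⊆C , fixed , C⊆T =
    C , (λ i Ui → U⊆C (∈-toSubset⁺ U? Ui)) , (λ k prod → fixed (∈-toSubset⁺ (grow? C) (inj₂ prod))) , C⊆T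

module AdjacencySums {n d : ℕ} (S : Scheme n d) {c ℓ : Level} (F : Field c ℓ) where
  open Scheme S
  open SchemeProperties S using (val≡rowCount)
  open Field F
  open FieldOps F using (sum; ι)
  open FieldSums F using (indicator; indicator-yes; indicator-no; sum-indicator≈ι-count)
  open OverField F
  open import Algebra.Properties.Semiring.Sum semiring using (sum-cong-≋; sum-remove; sum-replicate-zero)
  open import Relation.Binary.Reasoning.Setoid setoid

  rowSum-A : ∀ j x → sum (λ z → A j x z) ≈ ι (val j)
  rowSum-A j x = trans (sum-indicator≈ι-count (λ z → rel x z ≟ j))
                       (reflexive (≡.cong ι (≡.sym (val≡rowCount x j))))

  A⁺ : {C : Pred Idx 0ℓ} → Decidable C → Mat
  A⁺ C? x y = sum (λ i → indicator (C? i) * A i x y)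

  A⁺≈indicator : {C : Pred Idx 0ℓ} (C? : Decidable C) → ∀ x y → A⁺ C? x y ≈ indicator (C? (rel x y))
  A⁺≈indicator C? x y = begin
    sum t                                     ≈⟨ sum-remove {i = rel x y} t ⟩
    t (rel x y) + sum (t ∘ punchIn (rel x y)) ≈⟨ +-cong diagonal (trans (sum-cong-≋ off-diagonal) (sum-replicate-zero d)) ⟩
    indicator (C? (rel x y)) + 0#             ≈⟨ +-identityʳ _ ⟩
    indicator (C? (rel x y))                  ∎
    where
    t : Idx → Carrier
    t i = indicator (C? i) * A i x y
    diagonal : t (rel x y) ≈ indicator (C? (rel x y))
    diagonal = trans (*-congˡ (indicator-yes (rel x y ≟ rel x y) ≡.refl)) (*-identityʳ _)
    off-diagonal : ∀ j → t (punchIn (rel x y) j) ≈ 0#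
    off-diagonal j = trans (*-congˡ (indicator-no (rel x y ≟ _) (punchInᵢ≢i (rel x y) j ∘ ≡.sym))) (zeroʳ _)

  module _ {C : Pred Idx 0ℓ} (C? : Decidable C) (j : Idx) (x y : Fin n) where

    restrictedRowSum : Carrier
    restrictedRowSum = sum (λ z → A j x z * indicator (C? (rel z y)))

    restrictedRowSum-full : (∀ {z} → rel x z ≡ j → C (rel z y)) → restrictedRowSum ≈ ι (val j)
    restrictedRowSum-full full = trans (sum-cong-≋ keep) (rowSum-A j x)
      where
      keep : ∀ z → A j x z * indicator (C? (rel z y)) ≈ A j x z
      keep z with rel x z ≟ j
      ... | yes e = trans (*-identityˡ _) (indicator-yes (C? (rel z y)) (full e))
      ... | no _  = zeroˡ _

    restrictedRowSum-empty : (∀ {z} → rel x z ≡ j → ¬ C (rel z y)) → restrictedRowSum ≈ 0#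
    restrictedRowSum-empty empty = trans (sum-cong-≋ drop) (sum-replicate-zero n)
      where
      drop : ∀ z → A j x z * indicator (C? (rel z y)) ≈ 0#
      drop z with rel x z ≟ j
      ... | yes e = trans (*-identityˡ _) (indicator-no (C? (rel z y)) (empty e))
      ... | no _  = zeroˡ _

  module TrivialA⁺ {C : Pred Idx 0ℓ} (C? : Decidable C)
                   (∼-isEquivalence : IsEquivalence (λ x y → C (rel x y)))
                   (j*j⊆C : ∀ {x z₀ z} → rel x z₀ ≡ rel x z → C (rel z₀ z))
                   (valency-vanishes : ∀ {j} → ¬ C j → ι (val j) ≈ 0#) where
    open IsEquivalence ∼-isEquivalence renaming (refl to ∼-refl; sym to ∼-sym; trans to ∼-trans)

    row-dichotomy : ∀ j x y → (∀ {z} → rel x z ≡ j → C (rel z y)) ⊎ (∀ {z} → rel x z ≡ j → ¬ C (rel z y))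
    row-dichotomy j x y with any? (λ z → (rel x z ≟ j) ×-dec C? (rel z y))
    ... | yes (z₀ , e₀ , Cz₀y) = inj₁ (λ e → ∼-trans (j*j⊆C (≡.trans e (≡.sym e₀))) Cz₀y)
    ... | no none = inj₂ (λ e Czy → none (_ , e , Czy))

    restrictedRowSum≈ : ∀ j x y → restrictedRowSum C? j x y ≈ ι (val j) * indicator (C? (rel x y))
    restrictedRowSum≈ j x y with C? j | C? (rel x y)
    ... | yes Cj | yes Cxy =
      trans (restrictedRowSum-full C? j x y (λ e → ∼-trans (∼-sym (≡.subst C (≡.sym e) Cj)) Cxy))
            (sym (*-identityʳ _))
    ... | yes Cj | no ¬Cxy =
      trans (restrictedRowSum-empty C? j x y (λ e Czy → ¬Cxy (∼-trans (≡.subst C (≡.sym e) Cj) Czy)))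
            (sym (zeroʳ _))
    ... | no ¬Cj | _ = trans rowSum≈0 (sym (trans (*-congʳ (valency-vanishes ¬Cj)) (zeroˡ _)))
      where
      rowSum≈0 : restrictedRowSum C? j x y ≈ 0#
      rowSum≈0 with row-dichotomy j x y
      ... | inj₁ full  = trans (restrictedRowSum-full C? j x y full) (valency-vanishes ¬Cj)
      ... | inj₂ empty = restrictedRowSum-empty C? j x y empty

    A-eigen : ∀ j x y → (A j ·M A⁺ C?) x y ≈ ι (val j) * A⁺ C? x y
    A-eigen j x y = begin
      sum (λ z → A j x z * A⁺ C? z y)     ≈⟨ sum-cong-≋ (λ z → *-congˡ (A⁺≈indicator C? z y)) ⟩
      restrictedRowSum C? j x y            ≈⟨ restrictedRowSum≈ j x y ⟩
      ι (val j) * indicator (C? (rel x y)) ≈⟨ *-congˡ (A⁺≈indicator C? x y) ⟨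
      ι (val j) * A⁺ C? x y                ∎

    A⁺-trivial : TrivialVec (A⁺ C?)
    A⁺-trivial = ((indicator ∘ C?) , λ _ _ → refl) , (x , x , A⁺xx≉0) , A-eigen
      where
      x : Fin n
      x = proj₁ (nonempty fzero)
      A⁺xx≉0 : ¬ (A⁺ C? x x ≈ 0#)
      A⁺xx≉0 h = 1≉0 (trans (sym (trans (A⁺≈indicator C? x x) (indicator-yes (C? (rel x x)) ∼-refl))) h)

  allOf? : Decidable (λ (_ : Idx) → ⊤)
  allOf? _ = yes tt

  A⁺-all-trivial : TrivialVec (A⁺ allOf?)
  A⁺-all-trivial = TrivialA⁺.A⁺-trivial allOf? all-isEquivalence (λ _ → tt) (λ ¬⊤ → contradiction tt ¬⊤)
    where
    all-isEquivalence : IsEquivalence (λ x y → ⊤)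
    all-isEquivalence = record { refl = tt ; sym = λ _ → tt ; trans = λ _ _ → tt }

  spans-A⁺-all⇒full : {C : Pred Idx 0ℓ} (C? : Decidable C) →
                      (∃ λ a → ∀ x y → A⁺ allOf? x y ≈ a * A⁺ C? x y) → ∀ i → C i
  spans-A⁺-all⇒full C? (a , all≈aC) i with nonempty i
  ... | x , y , ≡.refl = decidable-stable (C? (rel x y)) λ ¬C → 1≉0 (begin
    1#                             ≈⟨ trans (A⁺≈indicator allOf? x y) (indicator-yes (allOf? (rel x y)) tt) ⟨
    A⁺ allOf? x y                  ≈⟨ all≈aC x y ⟩
    a * A⁺ C? x y                  ≈⟨ *-congˡ (trans (A⁺≈indicator C? x y) (indicator-no (C? (rel x y)) ¬C)) ⟩
    a * 0#                         ≈⟨ zeroʳ a ⟩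
    0#                             ∎)

module _ {c ℓ : Level} (F : Field c ℓ) {q : ℕ} (char : HasCharacteristic F q)
         {n d : ℕ} (S : Scheme n d) where
  open Scheme S
  open SchemeProperties S
  open AdjacencySums S F
  open Field F using (_≈_; 0#)
  open FieldOps F using (ι)
  open OverField F using (PTransitive; TrivialVec)
  open FieldSums.Characteristic F char using (ι-divisible≈0; char∤1)
  open import Data.Fin.Subset using (Subset; _∈_)
  open import Data.Fin.Subset.Properties using (_∈?_)

  module _ (Oθ-upper⊆Oθ-lower : ∀ i → Oθ-upper i → Oθ-lower i) where

    Oθ-upper⊆Sp′ : ∀ {i} → Oθ-upper i → Sp′ q i
    Oθ-upper⊆Sp′ {i} upper q∣val = char∤1 (≡.subst (q ∣_) (Oθ-upper⊆Oθ-lower i upper) q∣val)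

    0∈Sp′ : Sp′ q fzero
    0∈Sp′ = Oθ-upper⊆Sp′ (λ _ → closed⇒0∈ ∘ proj₁)

    module _ (C : Subset (suc d)) (Sp′⊆C : Sp′ q ⊆ (_∈ C)) (C-closed : ProductClosed (_∈ C)) where

      C-isEquivalence : IsEquivalence (λ x y → rel x y ∈ C)
      C-isEquivalence = closed⇒isEquivalence ((fzero , Sp′⊆C fzero 0∈Sp′) , C-closed)

      j*j⊆C : ∀ {x z₀ z} → rel x z₀ ≡ rel x z → rel z₀ z ∈ C
      j*j⊆C {x} {z₀} {z} e = Sp′⊆C _ (Oθ-upper⊆Sp′ (j*j⊆Oθ-upper (rel x z) (j*j-positive e)))

      valency-vanishes : ∀ {j} → ¬ j ∈ C → ι (val j) ≈ 0#
      valency-vanishes {j} j∉C = ι-divisible≈0 (decidable-stable (q ∣? val j) (j∉C ∘ Sp′⊆C j))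

      A⁺-closed⊇Sp′-trivial : TrivialVec (A⁺ (_∈? C))
      A⁺-closed⊇Sp′-trivial = TrivialA⁺.A⁺-trivial (_∈? C) C-isEquivalence j*j⊆C valency-vanishes

      decidableClosed⊇Sp′-full : PTransitive → ∀ i → i ∈ C
      decidableClosed⊇Sp′-full (_ , unique) =
        spans-A⁺-all⇒full (_∈? C) (proj₁ (unique _ _ A⁺-closed⊇Sp′-trivial A⁺-all-trivial))

    closed⊇Sp′-full : PTransitive → ∀ T → Closed T → Sp′ q ⊆ T → ∀ i → T i
    closed⊇Sp′-full pt T T-closed Sp′⊆T i =
      let C , Sp′⊆C , C-closed , C⊆T = decidableClosed-between (λ j → ¬? (q ∣? val j)) T-closed Sp′⊆T
      in C⊆T i (decidableClosed⊇Sp′-full C Sp′⊆C C-closed pt i)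

corollary4p4 : ∀ {c ℓ : Level} (F : Field c ℓ) (q : ℕ) → HasCharacteristic F q →
    ∀ (n d : ℕ) (S : Scheme n d) →
    let open Scheme S in
    (∀ i → Oθ-upper i → Oθ-lower i) →
    OverField.PTransitive F →
    Closed (λ _ → ⊤) × (∀ (T : SubsetS) → Closed T → Sp′ q ⊆ T → ∀ i → T i)
corollary4p4 F q char n d S Oθ-upper⊆Oθ-lower pTransitive =
  ((fzero , tt) , λ _ _ → tt) , closed⊇Sp′-full F char S Oθ-upper⊆Oθ-lower pTransitive
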